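{- Let $G$ be a finite simple graph, $X\subseteq V(G)$, and $M$ an $X$-minor of $G$. If $M$ has an $X$-spanning path (respectively, an $X$-spanning cycle) as a subgraph, then $G$ contains an $X$-spanning generalized path (respectively, an $X$-spanning generalized cycle).
   Context: For adjacent $x,y$, $G/xy$ is obtained from $G$ by deleting $y$ and adding an edge $xz$ for every $z$ with $yz\in E(G)$, $xz\notin E(G)$; the edge is $X$-legal if $y\notin X$. An $X$-minor of $G$ is a graph obtained from a subgraph of $G$ containing $X$ by a (possibly empty) sequence of contractions of $X$-legal edges. A subgraph $H$ is $X$-spanning if $X\subseteq V(H)$. A subgraph $H$ of $G$ is an $X$-spanning generalized cycle if $H$ is the edge-disjoint union of a cycle $C$ of $G$ and $|X|$ pairwise vertex-disjoint paths $P[x_i,y_i]$ of $G$ connecting $x_i$ and $y_i$ (possibly $x_i=y_i$), where $X=\{x_1,\dots,x_{|X|}\}$, such that $X\cap V(P[x_i,y_i])=\{x_i\}$ and $V(C)\cap V(P[x_i,y_i])=\{y_i\}$ for all $i$. An $X$-spanning generalized path is defined in the same way with the cycle $C$ replaced by a path of $G$. -}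

module Defs where

open import Data.Nat using (ℕ; _≤_)
open import Data.List using (List; []; _∷_; _++_; [_]; length; head; last; lookup)
open import Data.List.Membership.Propositional using (_∈_; _∉_)
open import Data.List.Relation.Unary.All using (All)
open import Data.List.Relation.Unary.Unique.Propositional using (Unique)
open import Data.List.Relation.Unary.Linked using (Linked)
open import Data.Fin using (Fin)
open import Data.Maybe using (just)
open import Data.Product using (Σ; ∃; _×_; _,_; proj₁; proj₂)
open import Data.Sum using (_⊎_; inj₁; inj₂)
open import Relation.Nullary using (¬_)
open import Relation.Binary.PropositionalEquality using (_≡_; _≢_; refl; sym)

record Graph : Set₁ where
  field
    V     : ℕ → Set
    E     : ℕ → ℕ → Set
    E-sym : ∀ {u v} → E u v → E v u
    E-irr : ∀ {u} → ¬ E u u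
    E-V   : ∀ {u v} → E u v → V u
    fin   : Σ (List ℕ) λ l → ∀ {v} → V v → v ∈ l
open Graph public

Subgraph : Graph → Graph → Set
Subgraph H G = (∀ {v} → V H v → V G v) × (∀ {u v} → E H u v → E G u v)

-- Contraction G/xy (for an edge xy): delete y, and join x to every
-- neighbour z ≠ x of y (no multiple edges arise, edges are a relation).
contract : (G : Graph) (x y : ℕ) → E G x y → Graph
contract G x y exy = record
  { V     = λ v → V G v × v ≢ y
  ; E     = CE
  ; E-sym = sym'
  ; E-irr = λ { ((_ , _ , u≢u) , _) → u≢u refl }
  ; E-V   = ev
  ; fin   = proj₁ (fin G) , λ { (vv , _) → proj₂ (fin G) vv }
  }
  where
  CE : ℕ → ℕ → Set
  CE u v = (u ≢ y × v ≢ y × u ≢ v) ×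
           (E G u v ⊎ (u ≡ x × E G y v) ⊎ (v ≡ x × E G y u))
  sym' : ∀ {u v} → CE u v → CE v u
  sym' ((a , b , c) , inj₁ e) = (b , a , λ p → c (sym p)) , inj₁ (E-sym G e)
  sym' ((a , b , c) , inj₂ (inj₁ p)) = (b , a , λ q → c (sym q)) , inj₂ (inj₂ p)
  sym' ((a , b , c) , inj₂ (inj₂ p)) = (b , a , λ q → c (sym q)) , inj₂ (inj₁ p)
  ev : ∀ {u v} → CE u v → V G u × u ≢ y
  ev ((a , _ , _) , inj₁ e) = E-V G e , a
  ev ((a , _ , _) , inj₂ (inj₁ (refl , _))) = E-V G exy , a
  ev ((a , _ , _) , inj₂ (inj₂ (_ , e))) = E-V G (E-sym G e) , a

-- M is an X-minor of G: obtained from a subgraph of G containing X by a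
-- (possibly empty) sequence of contractions of X-legal edges xy (y ∉ X).
data XMinor (X : List ℕ) (G : Graph) : Graph → Set₁ where
  base : (H : Graph) → Subgraph H G → All (V H) X → XMinor X G H
  step : {M : Graph} → XMinor X G M → (x y : ℕ) (e : E M x y) → y ∉ X →
         XMinor X G (contract M x y e)

-- A path of G, given by its vertex sequence (at least one vertex,
-- pairwise distinct, consecutive vertices adjacent).
IsPath : Graph → List ℕ → Set
IsPath G vs = (∃ λ v → head vs ≡ just v) × Unique vs × All (V G) vs × Linked (E G) vs

IsPathFromTo : Graph → ℕ → ℕ → List ℕ → Set
IsPathFromTo G a b vs = IsPath G vs × head vs ≡ just a × last vs ≡ just b

-- A cycle of G: distinct vertices v ∷ ws (at least 3), consecutive
-- vertices adjacent and the last adjacent to the first v.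
IsCycle : Graph → List ℕ → Set
IsCycle G []       = Data.Empty.⊥
  where import Data.Empty
IsCycle G (v ∷ ws) = 2 ≤ length ws × Unique (v ∷ ws) × All (V G) (v ∷ ws) ×
                     Linked (E G) ((v ∷ ws) ++ [ v ])

Spans : List ℕ → List ℕ → Set
Spans X vs = All (_∈ vs) X

HasSpanningPath : Graph → List ℕ → Set
HasSpanningPath G X = ∃ λ vs → IsPath G vs × Spans X vs

HasSpanningCycle : Graph → List ℕ → Set
HasSpanningCycle G X = ∃ λ vs → IsCycle G vs × Spans X vs

-- The "legs" of a generalized path/cycle with core C (vertex list):
-- for each x_i = lookup X i a path P i of G from x_i to y_i, pairwise
-- vertex-disjoint, with X ∩ V(P i) = {x_i} and V(C) ∩ V(P i) = {y_i}.
Legs : Graph → List ℕ → List ℕ → Set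
Legs G X C =
  Σ (Fin (length X) → ℕ) λ y →
  Σ (Fin (length X) → List ℕ) λ P →
    (∀ i → IsPathFromTo G (lookup X i) (y i) (P i)) ×
    (∀ i j → i ≢ j → ∀ v → v ∈ P i → v ∈ P j → Data.Empty.⊥) ×
    (∀ i v → v ∈ X → v ∈ P i → v ≡ lookup X i) ×
    (∀ i → y i ∈ C) ×
    (∀ i v → v ∈ C → v ∈ P i → v ≡ y i)
  where import Data.Empty

HasGenPath : Graph → List ℕ → Set
HasGenPath G X = ∃ λ C → IsPath G C × Legs G X C

HasGenCycle : Graph → List ℕ → Set
HasGenCycle G X = ∃ λ C → IsCycle G C × Legs G X C

module Submission where

-- A generalized path/cycle is a "core" (a path or a cycle) with "legs":
-- disjoint paths from the vertices of X to the core.  A spanning core is a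
-- generalized one with single-vertex legs, so it suffices to show that a
-- generalized core of a fixed shape passes from an X-minor back to G
-- (minor-gen, by induction on the minor).  Subgraphs are immediate.  For
-- the contraction M' = M/xy of an X-legal edge (y ∉ X), a list of M'
-- avoiding x is already one of M; otherwise x is replaced by a "bridge"
-- (x, y, xy or yx) whose ends are adjacent in M to the neighbours of x.
-- This lifts paths directly and cycles after rotating them to start at x.
-- Legs are lifted in the same way, except the (unique) leg through x when
-- x is on the core: that leg ends at x and is re-ended at whichever of
-- x, y the lifted core contains.

open import Defs
open import Data.Nat using (ℕ; _≤_; _≟_)
open import Data.Nat.Properties using (≤-trans; m≤n+m; suc-injective)
open import Data.List using (List; []; _∷_; _++_; [_]; length; head; last; lookup)
open import Data.List.Properties using (++-assoc; length-++)
open import Data.List.Membership.Propositional using (_∈_; _∉_)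
open import Data.List.Membership.Propositional.Properties
  using (∈-++⁺ˡ; ∈-++⁺ʳ; ∈-++⁻; ∈-∃++; ∈-lookup)
open import Data.List.Membership.DecPropositional _≟_ using (_∈?_)
open import Data.List.Relation.Unary.All as All using (All; []; _∷_)
import Data.List.Relation.Unary.All.Properties as All
open import Data.List.Relation.Unary.Any using (here; there)
open import Data.List.Relation.Unary.AllPairs using ([]; _∷_)
open import Data.List.Relation.Unary.Unique.Propositional using (Unique)
open import Data.List.Relation.Unary.Unique.Propositional.Properties
  using (Unique[x∷xs]⇒x∉xs) renaming (++⁺ to unique-++⁺)
open import Data.List.Relation.Unary.Linked as Linked using (Linked; []; [-]; _∷_)
open import Data.List.Relation.Binary.Disjoint.Propositional using (Disjoint)
open import Data.List.Relation.Binary.Permutation.Propositional using (_↭_; ↭-refl; ↭-sym; ↭⇒↭ₛ)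
open import Data.List.Relation.Binary.Permutation.Propositional.Properties
  using (∈-resp-↭; All-resp-↭; ↭-length; shift; shifts; ++-comm)
import Data.List.Relation.Binary.Permutation.Setoid.Properties as SetoidPerm
open import Data.Fin as Fin using (Fin)
open import Data.Maybe using (just)
open import Data.Product using (Σ; ∃; _×_; _,_; proj₁; proj₂)
open import Data.Sum using (_⊎_; inj₁; inj₂) renaming ([_,_] to either; map to ⊎-map)
open import Data.Empty using (⊥; ⊥-elim)
open import Function using (_∘_; id)
open import Relation.Nullary using (yes; no)
open import Relation.Binary.PropositionalEquality
  using (_≡_; _≢_; refl; sym; trans; cong; subst; subst₂; setoid)

module _ {A : Set} where

  unique-resp-↭ : {xs ys : List A} → xs ↭ ys → Unique xs → Unique ys
  unique-resp-↭ p = SetoidPerm.Unique-resp-↭ (setoid A) (↭⇒↭ₛ p)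

  unique-mid : ∀ as bs {u : A} → Unique (as ++ u ∷ bs) → u ∉ as ++ bs
  unique-mid as bs {u} u! = Unique[x∷xs]⇒x∉xs (unique-resp-↭ (shift u as bs) u!)

  unique-splice : ∀ as bs {u : A} {ms} → Unique (as ++ u ∷ bs) → Unique ms →
                  Disjoint ms (as ++ bs) → Unique (as ++ ms ++ bs)
  unique-splice as bs {u} {ms} u! ms! ms#rest =
    unique-resp-↭ (↭-sym (shifts as ms)) (unique-++⁺ ms! rest! ms#rest)
    where
    rest! : Unique (as ++ bs)
    rest! with unique-resp-↭ (shift u as bs) u!
    ... | _ ∷ r = r

  last-++ : ∀ (xs : List A) {z zs} → last (xs ++ z ∷ zs) ≡ last (z ∷ zs)
  last-++ []           = refl
  last-++ (a ∷ [])     = refl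
  last-++ (a ∷ b ∷ xs) = last-++ (b ∷ xs)

  last-∈ : ∀ (xs : List A) {a} → last xs ≡ just a → a ∈ xs
  last-∈ (b ∷ [])     refl = here refl
  last-∈ (b ∷ c ∷ xs) p    = there (last-∈ (c ∷ xs) p)

  last-split : ∀ (xs : List A) {a} → last xs ≡ just a → ∃ λ ys → xs ≡ ys ++ [ a ]
  last-split (b ∷ [])     refl = [] , refl
  last-split (b ∷ c ∷ xs) p with last-split (c ∷ xs) p
  ... | ys , eq = b ∷ ys , cong (b ∷_) eq

  lookup-injective : ∀ {xs : List A} → Unique xs → ∀ i j → lookup xs i ≡ lookup xs j → i ≡ j
  lookup-injective (_ ∷ _)  Fin.zero    Fin.zero    _ = refl
  lookup-injective (px ∷ _) Fin.zero    (Fin.suc j) e = ⊥-elim (All.lookup px (∈-lookup j) e)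
  lookup-injective (px ∷ _) (Fin.suc i) Fin.zero    e = ⊥-elim (All.lookup px (∈-lookup i) (sym e))
  lookup-injective (_ ∷ u)  (Fin.suc i) (Fin.suc j) e = cong Fin.suc (lookup-injective u i j e)

module _ {A : Set} {R : A → A → Set} where

  linked-split : ∀ xs {u ys} → Linked R (xs ++ u ∷ ys) → Linked R (xs ++ [ u ]) × Linked R (u ∷ ys)
  linked-split []           l       = [-] , l
  linked-split (a ∷ [])     (r ∷ l) = r ∷ [-] , l
  linked-split (a ∷ b ∷ xs) (r ∷ l) with linked-split (b ∷ xs) l
  ... | l₁ , l₂ = r ∷ l₁ , l₂

  linked-join : ∀ xs {u ys} → Linked R (xs ++ [ u ]) → Linked R (u ∷ ys) → Linked R (xs ++ u ∷ ys)
  linked-join []           _         l = l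
  linked-join (a ∷ [])     (r ∷ [-]) l = r ∷ l
  linked-join (a ∷ b ∷ xs) (r ∷ l₁)  l = r ∷ linked-join (b ∷ xs) l₁ l

subgraph-path : ∀ {H G L} → Subgraph H G → IsPath H L → IsPath G L
subgraph-path (sv , se) (h , u , vs , l) = h , u , All.map sv vs , Linked.map se l

subgraph-cycle : ∀ {H G} C → Subgraph H G → IsCycle H C → IsCycle G C
subgraph-cycle (_ ∷ _) (sv , se) (len , u , vs , l) = len , u , All.map sv vs , Linked.map se l

subgraph-legs : ∀ {H G X C} → Subgraph H G → Legs H X C → Legs G X C
subgraph-legs {H} {G} s (ends , P , paths , rest) =
  ends , P , (λ i → subgraph-path {H} {G} s (proj₁ (paths i)) , proj₂ (paths i)) , rest

singleton-legs : ∀ {G X C} → Unique X → All (V G) C → Spans X C → Legs G X C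
singleton-legs {G} {X} {C} X! vs span =
  lookup X , (λ i → [ lookup X i ]) , path , disjoint ,
  (λ { _ _ _ (here p) → p }) , (λ i → All.lookup span (∈-lookup i)) , (λ { _ _ _ (here p) → p })
  where
  path : ∀ i → IsPathFromTo G (lookup X i) (lookup X i) [ lookup X i ]
  path i = ((_ , refl) , [] ∷ [] , All.lookup vs (All.lookup span (∈-lookup i)) ∷ [] , [-]) , refl , refl
  disjoint : ∀ i j → i ≢ j → ∀ v → v ∈ [ lookup X i ] → v ∈ [ lookup X j ] → ⊥
  disjoint i j i≢j v (here p) (here q) = i≢j (lookup-injective X! i j (trans (sym p) q))

rotate : ∀ {G} v as u bs → IsCycle G (v ∷ as ++ u ∷ bs) → IsCycle G (u ∷ bs ++ v ∷ as)
rotate {G} v as u bs (len , u! , vs , l) =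
  subst (2 ≤_) (suc-injective (↭-length p)) len ,
  unique-resp-↭ p u! , All-resp-↭ p vs , closed
  where
  p : (v ∷ as) ++ (u ∷ bs) ↭ (u ∷ bs) ++ (v ∷ as)
  p = ++-comm (v ∷ as) (u ∷ bs)
  halves : Linked (E G) ((v ∷ as) ++ [ u ]) × Linked (E G) (u ∷ bs ++ [ v ])
  halves = linked-split (v ∷ as) (subst (Linked (E G)) (++-assoc (v ∷ as) (u ∷ bs) [ v ]) l)
  closed : Linked (E G) ((u ∷ bs ++ v ∷ as) ++ [ u ])
  closed = subst (Linked (E G)) (sym (++-assoc (u ∷ bs) (v ∷ as) [ u ]))
                 (linked-join (u ∷ bs) (proj₂ halves) (proj₁ halves))

start-at : ∀ {G C u} → IsCycle G C → u ∈ C → ∃ λ W → IsCycle G (u ∷ W) × C ↭ u ∷ W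
start-at {C = v ∷ ws} c (here refl) = ws , c , ↭-refl
start-at {G} {v ∷ ws} {u} c (there u∈ws) with ∈-∃++ u∈ws
... | as , bs , refl = bs ++ v ∷ as , rotate {G} v as u bs c , ++-comm (v ∷ as) (u ∷ bs)

module Uncontract (M : Graph) (x y : ℕ) (xy : E M x y) where

  M' : Graph
  M' = contract M x y xy

  x≢y : x ≢ y
  x≢y refl = E-irr M xy

  y∉ : ∀ {L} → All (V M') L → y ∉ L
  y∉ vs p = proj₂ (All.lookup vs p) refl

  real-edge : ∀ {u v} → x ≢ u → x ≢ v → E M' u v → E M u v
  real-edge _   _   (_ , inj₁ e)                = e
  real-edge x≢u _   (_ , inj₂ (inj₁ (u≡x , _))) = ⊥-elim (x≢u (sym u≡x))
  real-edge _   x≢v (_ , inj₂ (inj₂ (v≡x , _))) = ⊥-elim (x≢v (sym v≡x))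

  real-linked : ∀ {L} → x ∉ L → Linked (E M') L → Linked (E M) L
  real-linked _   []      = []
  real-linked _   [-]     = [-]
  real-linked x∉L (e ∷ l) =
    real-edge (x∉L ∘ here) (x∉L ∘ there ∘ here) e ∷ real-linked (x∉L ∘ there) l

  avoiding-path : ∀ {L} → x ∉ L → IsPath M' L → IsPath M L
  avoiding-path x∉L (h , u , vs , l) = h , u , All.map proj₁ vs , real-linked x∉L l

  avoiding-cycle : ∀ C → x ∉ C → IsCycle M' C → IsCycle M C
  avoiding-cycle (v ∷ ws) x∉C (len , u , vs , l) =
    len , u , All.map proj₁ vs , real-linked x∉closed l
    where
    x∉closed : x ∉ (v ∷ ws) ++ [ v ]
    x∉closed p with ∈-++⁻ (v ∷ ws) p
    ... | inj₁ q        = x∉C q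
    ... | inj₂ (here q) = x∉C (here q)

  data Side : Set where
    atX atY : Side

  pt : Side → ℕ
  pt atX = x
  pt atY = y

  pt-∈ : ∀ s → V M (pt s)
  pt-∈ atX = E-V M xy
  pt-∈ atY = E-V M (E-sym M xy)

  attach-edge : ∀ {a} → x ≢ a → E M' a x → Σ Side λ s → E M a (pt s)
  attach-edge _   (_ , inj₁ e)                = atX , e
  attach-edge x≢a (_ , inj₂ (inj₁ (a≡x , _))) = ⊥-elim (x≢a (sym a≡x))
  attach-edge _   (_ , inj₂ (inj₂ (_ , e)))   = atY , E-sym M e

  attach-left : ∀ as → x ∉ as → Linked (E M') (as ++ [ x ]) →
                Σ Side λ s → Linked (E M) (as ++ [ pt s ]) × (as ≡ [] → s ≡ atX)
  attach-left []           _   _         = atX , [-] , λ _ → refl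
  attach-left (a ∷ [])     x∉  (e ∷ [-]) with attach-edge (x∉ ∘ here) e
  ... | s , e' = s , e' ∷ [-] , λ ()
  attach-left (a ∷ b ∷ as) x∉  (e ∷ l)   with attach-left (b ∷ as) (x∉ ∘ there) l
  ... | s , l' , _ = s , real-edge (x∉ ∘ here) (x∉ ∘ there ∘ here) e ∷ l' , λ ()

  attach-right : ∀ bs → x ∉ bs → Linked (E M') (x ∷ bs) →
                 Σ Side λ t → Linked (E M) (pt t ∷ bs) × (bs ≡ [] → t ≡ atX)
  attach-right []       _  _       = atX , [-] , λ _ → refl
  attach-right (b ∷ bs) x∉ (e ∷ l) with attach-edge (x∉ ∘ here) (E-sym M' e)
  ... | t , e' = t , E-sym M e' ∷ real-linked x∉ l , λ ()

  -- The bridge from side s to side t: the shortest path of M from pt s to pt t.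
  bridge-tail : Side → Side → List ℕ
  bridge-tail atX atX = []
  bridge-tail atX atY = [ y ]
  bridge-tail atY atX = [ x ]
  bridge-tail atY atY = []

  bridge : Side → Side → List ℕ
  bridge s t = pt s ∷ bridge-tail s t

  bridge-linked : ∀ s t {bs} → Linked (E M) (pt t ∷ bs) → Linked (E M) (bridge s t ++ bs)
  bridge-linked atX atX l = l
  bridge-linked atX atY l = xy ∷ l
  bridge-linked atY atX l = E-sym M xy ∷ l
  bridge-linked atY atY l = l

  bridge-⊆ : ∀ s t {v} → v ∈ bridge s t → v ≡ pt s ⊎ v ≡ pt t
  bridge-⊆ _   _   (here p)                 = inj₁ p
  bridge-⊆ atX atY (there (here p))         = inj₂ p
  bridge-⊆ atY atX (there (here p))         = inj₂ p
  bridge-⊆ atX atX (there ())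
  bridge-⊆ atX atY (there (there ()))
  bridge-⊆ atY atX (there (there ()))
  bridge-⊆ atY atY (there ())

  bridge-xy : ∀ s t {v} → v ∈ bridge s t → v ≡ x ⊎ v ≡ y
  bridge-xy s t p = either (xy-pt s) (xy-pt t) (bridge-⊆ s t p)
    where
    xy-pt : ∀ r {v} → v ≡ pt r → v ≡ x ⊎ v ≡ y
    xy-pt atX = inj₁
    xy-pt atY = inj₂

  bridge-unique : ∀ s t → Unique (bridge s t)
  bridge-unique atX atX = [] ∷ []
  bridge-unique atX atY = (x≢y ∷ []) ∷ [] ∷ []
  bridge-unique atY atX = ((x≢y ∘ sym) ∷ []) ∷ [] ∷ []
  bridge-unique atY atY = [] ∷ []

  bridge-V : ∀ s t → All (V M) (bridge s t)
  bridge-V s t = All.tabulate λ p → either (at s) (at t) (bridge-⊆ s t p)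
    where
    at : ∀ r {v} → v ≡ pt r → V M v
    at r refl = pt-∈ r

  last-bridge : ∀ s t → last (bridge s t ++ []) ≡ just (pt t)
  last-bridge atX atX = refl
  last-bridge atX atY = refl
  last-bridge atY atX = refl
  last-bridge atY atY = refl

  module Splice (as bs : List ℕ) (s t : Side) where

    old new : List ℕ
    old = as ++ x ∷ bs
    new = as ++ bridge s t ++ bs

    rest-⊆ : ∀ {v} → v ∈ as ++ bs → v ∈ old
    rest-⊆ p with ∈-++⁻ as p
    ... | inj₁ q = ∈-++⁺ˡ q
    ... | inj₂ q = ∈-++⁺ʳ as (there q)

    new-⊆ : ∀ {v} → v ∈ new → v ∈ old ⊎ v ≡ y
    new-⊆ p with ∈-++⁻ as p
    ... | inj₁ q = inj₁ (∈-++⁺ˡ q)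
    ... | inj₂ q with ∈-++⁻ (bridge s t) q
    ...   | inj₂ r = inj₁ (∈-++⁺ʳ as (there r))
    ...   | inj₁ r with bridge-xy s t r
    ...     | inj₁ refl = inj₁ (∈-++⁺ʳ as (here refl))
    ...     | inj₂ refl = inj₂ refl

    old-⊆ : ∀ {v} → v ∈ old → v ≢ x → v ∈ new
    old-⊆ p v≢x with ∈-++⁻ as p
    ... | inj₁ q         = ∈-++⁺ˡ q
    ... | inj₂ (here q)  = ⊥-elim (v≢x q)
    ... | inj₂ (there q) = ∈-++⁺ʳ as (∈-++⁺ʳ (bridge s t) q)

    hits : pt s ∈ new
    hits = ∈-++⁺ʳ as (here refl)

    new-unique : Unique old → y ∉ old → Unique new
    new-unique old! y∉old = unique-splice as bs old! (bridge-unique s t) disjoint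
      where
      disjoint : Disjoint (bridge s t) (as ++ bs)
      disjoint (p , q) with bridge-xy s t p
      ... | inj₁ refl = unique-mid as bs old! q
      ... | inj₂ refl = y∉old (rest-⊆ q)

    new-V : All (V M') old → All (V M) new
    new-V vs with All.++⁻ as vs
    ... | vas , (_ ∷ vbs) =
      All.++⁺ (All.map proj₁ vas) (All.++⁺ (bridge-V s t) (All.map proj₁ vbs))

  record Lift (Shape : List ℕ → Set) (L : List ℕ) : Set where
    field
      lifted    : List ℕ
      shape     : Shape lifted
      lifted-⊆  : ∀ {v} → v ∈ lifted → v ∈ L ⊎ (v ≡ y × x ∈ L)
      ⊆-lifted  : ∀ {v} → v ∈ L → v ≢ x → v ∈ lifted
      meets-xy  : x ∈ L → x ∈ lifted ⊎ y ∈ lifted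

  map-lift : ∀ {S S' : List ℕ → Set} {L} → (∀ {N} → S N → S' N) → Lift S L → Lift S' L
  map-lift f l = record { Lift l ; shape = f (Lift.shape l) }

  transport-lift : ∀ {S L L'} → L ↭ L' → Lift S L' → Lift S L
  transport-lift p l = record
    { lifted   = lifted
    ; shape    = shape
    ; lifted-⊆ = λ q → ⊎-map (∈-resp-↭ (↭-sym p)) (λ { (e , x∈) → e , ∈-resp-↭ (↭-sym p) x∈ }) (lifted-⊆ q)
    ; ⊆-lifted = λ q → ⊆-lifted (∈-resp-↭ p q)
    ; meets-xy = λ q → meets-xy (∈-resp-↭ p q)
    }
    where open Lift l

  unchanged-lift : ∀ {S L} → x ∉ L → S L → Lift S L
  unchanged-lift x∉L sh = record
    { lifted = _ ; shape = sh ; lifted-⊆ = inj₁ ; ⊆-lifted = λ p _ → p ; meets-xy = ⊥-elim ∘ x∉L }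

  splice-lift : ∀ {S} as bs s t → S (Splice.new as bs s t) → Lift S (as ++ x ∷ bs)
  splice-lift as bs s t sh = record
    { lifted   = new
    ; shape    = sh
    ; lifted-⊆ = λ p → ⊎-map id (λ e → e , ∈-++⁺ʳ as (here refl)) (new-⊆ p)
    ; ⊆-lifted = old-⊆
    ; meets-xy = λ _ → pt-xy s hits
    }
    where
    open Splice as bs s t
    pt-xy : ∀ r → pt r ∈ new → x ∈ new ⊎ y ∈ new
    pt-xy atX = inj₁
    pt-xy atY = inj₂

  head-splice : ∀ as bs s t → (as ≡ [] → s ≡ atX) →
                head (Splice.new as bs s t) ≡ head (Splice.old as bs s t)
  head-splice []      _ s _ starts with starts refl
  ... | refl = refl
  head-splice (_ ∷ _) _ _ _ _ = refl

  last-splice : ∀ as bs s t → (bs ≡ [] → t ≡ atX) →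
                last (Splice.new as bs s t) ≡ last (Splice.old as bs s t)
  last-splice as [] s t ends with ends refl
  ... | refl = trans (last-++ as) (trans (last-bridge s atX) (sym (last-++ as)))
  last-splice as (b ∷ bs) s t _ =
    trans (last-++ as) (trans (last-++ (bridge s t)) (sym (last-++ as)))

  PathAlong : List ℕ → List ℕ → Set
  PathAlong L N = IsPath M N × head N ≡ head L × last N ≡ last L

  lift-path : ∀ L → IsPath M' L → Lift (PathAlong L) L
  lift-path L p with x ∈? L
  ... | no x∉L = unchanged-lift x∉L (avoiding-path x∉L p , refl , refl)
  ... | yes x∈L with ∈-∃++ x∈L
  ...   | as , bs , refl = splice as bs p
    where
    splice : ∀ as bs → IsPath M' (as ++ x ∷ bs) → Lift (PathAlong (as ++ x ∷ bs)) (as ++ x ∷ bs)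
    splice as bs ((_ , h) , u , vs , l) with linked-split as l
    ... | lˡ , lʳ
      with attach-left as (unique-mid as bs u ∘ ∈-++⁺ˡ) lˡ
         | attach-right bs (unique-mid as bs u ∘ ∈-++⁺ʳ as) lʳ
    ... | s , lˡ' , starts | t , lʳ' , ends =
      splice-lift as bs s t
        (((_ , trans heads h) , new-unique u (y∉ vs) , new-V vs ,
           linked-join as lˡ' (bridge-linked s t lʳ')) ,
         heads , last-splice as bs s t ends)
      where
      open Splice as bs s t
      heads : head new ≡ head old
      heads = head-splice as bs s t starts

  -- Cycles are lifted after rotating them to start at x; the bridge then
  -- closes the cycle.
  lift-cycle : ∀ C → IsCycle M' C → Lift (IsCycle M) C
  lift-cycle C c with x ∈? C
  ... | no x∉C = unchanged-lift x∉C (avoiding-cycle C x∉C c)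
  ... | yes x∈C with start-at {M'} c x∈C
  ...   | W , c' , C↭ = transport-lift C↭ (splice W c')
    where
    splice : ∀ W → IsCycle M' (x ∷ W) → Lift (IsCycle M) (x ∷ W)
    splice (w ∷ W) (len , u , vs , e ∷ l)
      with attach-left (w ∷ W) (Unique[x∷xs]⇒x∉xs u) l
         | attach-edge (Unique[x∷xs]⇒x∉xs u ∘ here) (E-sym M' e)
    ... | s , l' , _ | t , e' =
      splice-lift [] (w ∷ W) s t (len' , new-unique u (y∉ vs) , new-V vs , closed)
      where
      open Splice [] (w ∷ W) s t
      len' : 2 ≤ length (bridge-tail s t ++ w ∷ W)
      len' = ≤-trans len (subst (_ ≤_) (sym (length-++ (bridge-tail s t))) (m≤n+m _ _))
      closed : Linked (E M) ((bridge s t ++ w ∷ W) ++ [ pt s ])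
      closed = subst (Linked (E M)) (cong (pt s ∷_) (sym (++-assoc (bridge-tail s t) (w ∷ W) [ pt s ])))
                     (bridge-linked s t (E-sym M e' ∷ l'))

  record ReEnded (a : ℕ) (L N : List ℕ) : Set where
    field
      end      : ℕ
      path     : List ℕ
      is-path  : IsPathFromTo M a end path
      path-⊆   : ∀ {v} → v ∈ path → v ∈ L ⊎ v ≡ y
      end-∈    : end ∈ N
      only-end : ∀ {v} → v ∈ N → v ∈ path → v ≡ x ⊎ v ≡ y → v ≡ end

  other-side : ∀ {N} s → x ∈ N ⊎ y ∈ N → pt s ∉ N → Σ Side λ t → pt t ∈ N
  other-side atX (inj₁ p) ¬p = ⊥-elim (¬p p)
  other-side atX (inj₂ q) _  = atY , q
  other-side atY (inj₁ p) _  = atX , p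
  other-side atY (inj₂ q) ¬p = ⊥-elim (¬p q)

  choose-side : ∀ N → x ∈ N ⊎ y ∈ N → (s : Side) → Σ Side λ t → pt t ∈ N × (pt s ∈ N → t ≡ s)
  choose-side N x∨y s with pt s ∈? N
  ... | yes p = s , p , λ _ → refl
  ... | no ¬p with other-side s x∨y ¬p
  ...   | t , p = t , p , ⊥-elim ∘ ¬p

  -- The re-ended path: splice the bridge from the side reached by the
  -- path to the side chosen in N.
  re-end : ∀ {a} as N → IsPathFromTo M' a x (as ++ [ x ]) → x ∈ N ⊎ y ∈ N → ReEnded a (as ++ [ x ]) N
  re-end as N (((_ , h) , u , vs , l) , hd , _) x∨y
    with attach-left as (unique-mid as [] u ∘ ∈-++⁺ˡ) l
  ... | s , l' , starts with choose-side N x∨y s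
  ... | t , t∈N , keeps = record
    { end      = pt t
    ; path     = new
    ; is-path  = ((_ , trans heads h) , new-unique u (y∉ vs) , new-V vs ,
                  linked-join as l' (bridge-linked s t [-])) ,
                 trans heads hd , trans (last-++ as) (last-bridge s t)
    ; path-⊆   = new-⊆
    ; end-∈    = t∈N
    ; only-end = only-end
    }
    where
    open Splice as [] s t
    heads : head new ≡ head old
    heads = head-splice as [] s t starts
    only-end : ∀ {v} → v ∈ N → v ∈ new → v ≡ x ⊎ v ≡ y → v ≡ pt t
    only-end v∈N p v∈xy with ∈-++⁻ as p
    ... | inj₁ q = ⊥-elim (either (λ { refl → unique-mid as [] u (∈-++⁺ˡ q) })
                                  (λ { refl → y∉ vs (∈-++⁺ˡ q) }) v∈xy)
    ... | inj₂ q with ∈-++⁻ (bridge s t) q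
    ...   | inj₂ ()
    ...   | inj₁ r with bridge-⊆ s t r
    ...     | inj₂ v≡t = v≡t
    ...     | inj₁ refl with keeps v∈N
    ...       | refl = refl

  module LiftLegs {S : List ℕ → Set} {X C : List ℕ} (y∉X : y ∉ X) (y∉C : y ∉ C) (core : Lift S C)
    (end : Fin (length X) → ℕ) (P : Fin (length X) → List ℕ)
    (paths : ∀ i → IsPathFromTo M' (lookup X i) (end i) (P i))
    (disjoint : ∀ i j → i ≢ j → ∀ v → v ∈ P i → v ∈ P j → ⊥)
    (only-own : ∀ i v → v ∈ X → v ∈ P i → v ≡ lookup X i)
    (end-∈ : ∀ i → end i ∈ C)
    (meets : ∀ i v → v ∈ C → v ∈ P i → v ≡ end i) where

    module Core = Lift core

    N : List ℕ
    N = Core.lifted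

    y∉P : ∀ j → y ∉ P j
    y∉P j = y∉ (proj₁ (proj₂ (proj₂ (proj₁ (paths j)))))

    record NewLeg (j : Fin (length X)) : Set where
      field
        new-end  : ℕ
        new-path : List ℕ
        is-path  : IsPathFromTo M (lookup X j) new-end new-path
        path-⊆   : ∀ {v} → v ∈ new-path → v ∈ P j ⊎ (v ≡ y × x ∈ P j)
        end-∈N   : new-end ∈ N
        meets-N  : ∀ {v} → v ∈ N → v ∈ new-path → v ≡ new-end

    lifted-leg : ∀ j → x ∉ C ⊎ x ∉ P j → NewLeg j
    lifted-leg j x∉C∩P = record
      { new-end  = end j
      ; new-path = Leg.lifted
      ; is-path  = proj₁ Leg.shape , trans (proj₁ (proj₂ Leg.shape)) (proj₁ (proj₂ (paths j))) ,
                   trans (proj₂ (proj₂ Leg.shape)) (proj₂ (proj₂ (paths j)))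
      ; path-⊆   = Leg.lifted-⊆
      ; end-∈N   = Core.⊆-lifted (end-∈ j) end≢x
      ; meets-N  = meets-N
      }
      where
      module Leg = Lift (lift-path (P j) (proj₁ (paths j)))
      end≢x : end j ≢ x
      end≢x refl = either (λ x∉C → x∉C (end-∈ j))
                          (λ x∉P → x∉P (last-∈ (P j) (proj₂ (proj₂ (paths j))))) x∉C∩P
      meets-N : ∀ {v} → v ∈ N → v ∈ Leg.lifted → v ≡ end j
      meets-N v∈N v∈Q with Core.lifted-⊆ v∈N | Leg.lifted-⊆ v∈Q
      ... | inj₁ v∈C          | inj₁ v∈P          = meets j _ v∈C v∈P
      ... | inj₁ v∈C          | inj₂ (refl , _)   = ⊥-elim (y∉C v∈C)
      ... | inj₂ (refl , _)   | inj₁ v∈P          = ⊥-elim (y∉P j v∈P)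
      ... | inj₂ (_ , x∈C)    | inj₂ (_ , x∈P)    = ⊥-elim (either (λ n → n x∈C) (λ n → n x∈P) x∉C∩P)

    anchored-leg : ∀ i → x ∈ P i → x ∈ C → NewLeg i
    anchored-leg i x∈P x∈C =
      re-ended (last-split (P i) (trans (proj₂ (proj₂ (paths i))) (cong just (sym x≡end))))
      where
      x≡end : x ≡ end i
      x≡end = meets i x x∈C x∈P
      re-ended : (∃ λ as → P i ≡ as ++ [ x ]) → NewLeg i
      re-ended (as , P≡) = record
        { new-end  = R.end
        ; new-path = R.path
        ; is-path  = R.is-path
        ; path-⊆   = path-⊆
        ; end-∈N   = R.end-∈
        ; meets-N  = meets-N
        }
        where
        module R = ReEnded (re-end as N (subst₂ (IsPathFromTo M' (lookup X i)) (sym x≡end) P≡ (paths i))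
                                    (Core.meets-xy x∈C))
        path-⊆ : ∀ {v} → v ∈ R.path → v ∈ P i ⊎ (v ≡ y × x ∈ P i)
        path-⊆ p = ⊎-map (subst (_ ∈_) (sym P≡)) (λ e → e , x∈P) (R.path-⊆ p)
        meets-N : ∀ {v} → v ∈ N → v ∈ R.path → v ≡ R.end
        meets-N {v} v∈N v∈Q with v ≟ x | v ≟ y
        ... | yes v≡x | _       = R.only-end v∈N v∈Q (inj₁ v≡x)
        ... | no _    | yes v≡y = R.only-end v∈N v∈Q (inj₂ v≡y)
        ... | no v≢x  | no v≢y  with Core.lifted-⊆ v∈N | path-⊆ v∈Q
        ...   | inj₂ (v≡y , _) | _              = ⊥-elim (v≢y v≡y)
        ...   | _              | inj₂ (v≡y , _) = ⊥-elim (v≢y v≡y)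
        ...   | inj₁ v∈C       | inj₁ v∈P       = ⊥-elim (v≢x (trans (meets i v v∈C v∈P) (sym x≡end)))

    new-leg : ∀ j → NewLeg j
    new-leg j with x ∈? C | x ∈? P j
    ... | no x∉C  | _       = lifted-leg j (inj₁ x∉C)
    ... | yes _   | no x∉P  = lifted-leg j (inj₂ x∉P)
    ... | yes x∈C | yes x∈P = anchored-leg j x∈P x∈C

    -- New legs inherit disjointness and X-avoidance: they only add y,
    -- which is not in X and is added to the unique leg through x.
    new-legs : Legs M X N
    new-legs =
      NewLeg.new-end ∘ new-leg , NewLeg.new-path ∘ new-leg , NewLeg.is-path ∘ new-leg ,
      disjoint' , only-own' , NewLeg.end-∈N ∘ new-leg , λ j _ v∈N v∈Q → NewLeg.meets-N (new-leg j) v∈N v∈Q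
      where
      disjoint' : ∀ i j → i ≢ j → ∀ v → v ∈ NewLeg.new-path (new-leg i) → v ∈ NewLeg.new-path (new-leg j) → ⊥
      disjoint' i j i≢j v p q with NewLeg.path-⊆ (new-leg i) p | NewLeg.path-⊆ (new-leg j) q
      ... | inj₁ a          | inj₁ b          = disjoint i j i≢j v a b
      ... | inj₁ a          | inj₂ (refl , _) = y∉P i a
      ... | inj₂ (refl , _) | inj₁ b          = y∉P j b
      ... | inj₂ (_ , a)    | inj₂ (_ , b)    = disjoint i j i≢j x a b
      only-own' : ∀ j v → v ∈ X → v ∈ NewLeg.new-path (new-leg j) → v ≡ lookup X j
      only-own' j v v∈X p with NewLeg.path-⊆ (new-leg j) p
      ... | inj₁ a          = only-own j v v∈X a
      ... | inj₂ (refl , _) = ⊥-elim (y∉X v∈X)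

  lift-legs : ∀ {S X C} → y ∉ X → y ∉ C → (core : Lift S C) → Legs M' X C → Legs M X (Lift.lifted core)
  lift-legs y∉X y∉C core (end , P , paths , disjoint , only-own , end-∈ , meets) =
    LiftLegs.new-legs y∉X y∉C core end P paths disjoint only-own end-∈ meets

record CoreShape : Set₁ where
  field
    Shape      : Graph → List ℕ → Set
    vertices   : ∀ {G C} → Shape G C → All (V G) C
    supergraph : ∀ {H G C} → Subgraph H G → Shape H C → Shape G C
    uncontract : ∀ M x y (xy : E M x y) {C} → Shape (contract M x y xy) C →
                 Uncontract.Lift M x y xy (Shape M) C
open CoreShape

HasGen : CoreShape → Graph → List ℕ → Set
HasGen S G X = ∃ λ C → Shape S G C × Legs G X C

spanning-gen : ∀ S {G X} → Unique X → (∃ λ C → Shape S G C × Spans X C) → HasGen S G X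
spanning-gen S {G} X! (C , c , span) = C , c , singleton-legs {G} X! (vertices S c) span

minor-gen : ∀ S {X G M} → XMinor X G M → HasGen S M X → HasGen S G X
minor-gen S {G = G} (base H H⊆G _) (C , c , legs) =
  C , supergraph S H⊆G c , subgraph-legs {H} {G} H⊆G legs
minor-gen S (step {M} minor x y xy y∉X) (C , c , legs) =
  minor-gen S minor (lifted , shape , lift-legs y∉X (y∉ (vertices S c)) core legs)
  where
  open Uncontract M x y xy
  core : Lift (Shape S M) C
  core = uncontract S M x y xy c
  open Lift core

path-shape : CoreShape
path-shape = record
  { Shape      = IsPath
  ; vertices   = λ p → proj₁ (proj₂ (proj₂ p))
  ; supergraph = λ {H} {G} → subgraph-path {H} {G}
  ; uncontract = λ M x y xy {C} p →
      Uncontract.map-lift M x y xy proj₁ (Uncontract.lift-path M x y xy C p)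
  }

cycle-shape : CoreShape
cycle-shape = record
  { Shape      = IsCycle
  ; vertices   = λ {_} {C} → cycle-vertices C
  ; supergraph = λ {_} {_} {C} → subgraph-cycle C
  ; uncontract = λ M x y xy {C} → Uncontract.lift-cycle M x y xy C
  }
  where
  cycle-vertices : ∀ {G} C → IsCycle G C → All (V G) C
  cycle-vertices (_ ∷ _) (_ , _ , vs , _) = vs

mainTheorem11 : (G : Graph) (X : List ℕ) → Unique X → All (V G) X →
                (M : Graph) → XMinor X G M →
                (HasSpanningPath M X → HasGenPath G X) ×
                (HasSpanningCycle M X → HasGenCycle G X)
mainTheorem11 G X X! _ M minor =
  (λ spanning → minor-gen path-shape minor (spanning-gen path-shape {M} X! spanning)) ,
  (λ spanning → minor-gen cycle-shape minor (spanning-gen cycle-shape {M} X! spanning))
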